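{- For every finite string $W$ in the letters $A,B,X$, one has $|(ABAW)|=|[WABA]|$ in the tight puzzle, where $(ABAW)$ is the cyclic sentence of the string $ABAW$.
   Context: Tight puzzle: words with (coefficient, weight) $X$ $(1,0)$; $XA$ $(1,1)$; $XAA$ $(1,1)$; $AXA$ $(2,1)$; $AAA$ $(-1,1)$; $BA$ $(-1,1)$; $ABA$ $(-1,1)$; $XXA$ $(-1,1)$. A parsing is a decomposition of a string into consecutive words from this list, in which the word $X$ is never immediately followed by the word $XA$ nor by the word $BA$. A cyclic sentence $(U)$ is the string $U$ up to cyclic permutation, parsed cyclically. For a finite string $U$, the locked string $[U]$ has as parsings only the decompositions of the finite string $U$ itself into words (no padding). Coefficient of a parsing = product of coefficients of its words, weight = sum of weights; $c(S,w)$ = sum of coefficients of weight-$w$ parsings; $|S|=\sum_{w\ge0}c(S,w)t^w$. -}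

module Defs where

open import Data.Bool using (Bool; true; false; _∧_; not; if_then_else_)
open import Data.Nat using (ℕ; zero; suc; _≡ᵇ_; _<ᵇ_)
open import Data.Integer using (ℤ; 0ℤ; 1ℤ; -1ℤ; _*_; _+_) renaming (+_ to pos)
open import Data.List using (List; []; _∷_; _++_; map; concatMap; length; drop; take; upTo; foldr; last)
open import Data.Maybe using (Maybe; just; nothing)

data Letter : Set where
  A B X : Letter

String : Set
String = List Letter

data Word : Set where
  wX wXA wXAA wAXA wAAA wBA wABA wXXA : Word

allWords : List Word
allWords = wX ∷ wXA ∷ wXAA ∷ wAXA ∷ wAAA ∷ wBA ∷ wABA ∷ wXXA ∷ []

spell : Word → String
spell wX   = X ∷ []
spell wXA  = X ∷ A ∷ []
spell wXAA = X ∷ A ∷ A ∷ []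
spell wAXA = A ∷ X ∷ A ∷ []
spell wAAA = A ∷ A ∷ A ∷ []
spell wBA  = B ∷ A ∷ []
spell wABA = A ∷ B ∷ A ∷ []
spell wXXA = X ∷ X ∷ A ∷ []

coef : Word → ℤ
coef wX   = 1ℤ
coef wXA  = 1ℤ
coef wXAA = 1ℤ
coef wAXA = pos 2
coef wAAA = -1ℤ
coef wBA  = -1ℤ
coef wABA = -1ℤ
coef wXXA = -1ℤ

weight : Word → ℕ
weight wX = 0
weight _  = 1

forbidden : Word → Word → Bool
forbidden wX wXA = true
forbidden wX wBA = true
forbidden _  _   = false

admissible : List Word → Bool
admissible (u ∷ v ∷ rest) = not (forbidden u v) ∧ admissible (v ∷ rest)
admissible _ = true

cycAdmissible : List Word → Bool
cycAdmissible [] = true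
cycAdmissible (u ∷ rest) with last (u ∷ rest)
... | just l  = admissible (u ∷ rest) ∧ not (forbidden l u)
... | nothing = admissible (u ∷ rest)

eqLetter : Letter → Letter → Bool
eqLetter A A = true
eqLetter B B = true
eqLetter X X = true
eqLetter _ _ = false

eqString : String → String → Bool
eqString [] [] = true
eqString (a ∷ u) (b ∷ v) = eqLetter a b ∧ eqString u v
eqString _ _ = false

concatW : List Word → String
concatW ws = concatMap spell ws

wordListsOfLength : ℕ → List (List Word)
wordListsOfLength zero = [] ∷ []
wordListsOfLength (suc k) =
  concatMap (λ w → map (w ∷_) (wordListsOfLength k)) allWords

-- All lists of words of length at most n (a parsing of a string of
-- length n has at most n words, as every word is nonempty).
wordListsUpTo : ℕ → List (List Word)
wordListsUpTo n = concatMap wordListsOfLength (upTo (suc n))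

coefP : List Word → ℤ
coefP ws = foldr (λ w c → coef w * c) 1ℤ ws

weightP : List Word → ℕ
weightP ws = foldr (λ w n → weight w Data.Nat.+ n) 0 ws

sumℤ : List ℤ → ℤ
sumℤ = foldr _+_ 0ℤ

-- Parsings of the locked string [U]: decompositions of U itself.
isLockedParsing : String → List Word → Bool
isLockedParsing U ws = eqString (concatW ws) U ∧ admissible ws

cLocked : String → ℕ → ℤ
cLocked U w = sumℤ (map (λ ws →
  if isLockedParsing U ws ∧ (weightP ws ≡ᵇ w) then coefP ws else 0ℤ)
  (wordListsUpTo (length U)))

rotate : ℕ → String → String
rotate s U = drop s U ++ take s U

lastLongerThan : ℕ → List Word → Bool
lastLongerThan s ws with last ws
... | just l  = s <ᵇ length (spell l)
... | nothing = false

-- A cyclic parsing of (U), with |U| = n, is a nonempty set of cut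
-- positions in Z/n such that each arc between consecutive cuts is a
-- word, with the adjacency restriction applied cyclically.  It is
-- encoded uniquely by (s, ws) where s < n is the smallest cut position
-- and ws is the sequence of words read from position s around the cycle:
-- concat ws = rotate s U, and the last word (which wraps past position
-- 0 back to s) has length > s, so that no cut lies in [0, s).
isCyclicParsing : String → ℕ → List Word → Bool
isCyclicParsing U s ws =
  eqString (concatW ws) (rotate s U) ∧ lastLongerThan s ws ∧ cycAdmissible ws

cCyclic : String → ℕ → ℤ
cCyclic U w = sumℤ (concatMap (λ s → map (λ ws →
  if isCyclicParsing U s ws ∧ (weightP ws ≡ᵇ w) then coefP ws else 0ℤ)
  (wordListsUpTo (length U))) (upTo (length U)))

module Submission where

-- A cyclic parsing of (ABA·W) is encoded by (s, ws): s is its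
-- smallest cut, ws the words read from s.  Only s = 0, 1 occur: for s ≥ 3 the
-- wrapping last word would need length > 3, and for s = 2 the rotation A·W·AB
-- ends in B, which no word does.  For s = 0 the first word begins with AB, so
-- it is ABA, and ABA ∷ P ↦ P ++ [ABA] matches these parsings with the locked
-- parsings of [W·ABA] ending in ABA; for s = 1 the first word is BA, and
-- BA ∷ R ↦ R ++ [BA] matches them with those ending in BA (the cyclic demand
-- "last word longer than 1" excludes X, as does the rule forbidding X·BA).
-- Rotation keeps coefficient and weight, and every locked parsing of W·ABA
-- ends in ABA or BA, so the two cyclic sums add up to c([W·ABA], w).

open import Defs
open import Data.Nat using (ℕ)
open import Data.List using (List; []; _∷_; _++_)
open import Relation.Binary.PropositionalEquality using (_≡_)

open import Data.Nat using (zero; suc; _≡ᵇ_; _<ᵇ_) renaming (_+_ to _+ℕ_)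
import Data.Nat.Properties as ℕP
open import Data.Bool using (true; false; _∧_; not; if_then_else_)
open import Data.Bool.Properties using (∧-assoc; ∧-zeroʳ; ∧-identityʳ)
open import Data.Integer using (ℤ; 0ℤ; _*_; _+_)
import Data.Integer.Properties as ℤP
open import Data.Integer.Tactic.RingSolver using (solve-∀)
open import Algebra.Properties.CommutativeSemigroup ℤP.+-commutativeSemigroup using (interchange)
open import Data.List using (map; concatMap; length; last; upTo; applyUpTo; reverse)
open import Data.List.Properties
  using (++-assoc; ++-identityʳ; ++-cancelʳ; length-++-comm; reverse-++; map-∘; map-concatMap)
open import Data.Maybe using (just)
open import Relation.Nullary using (¬_)
open import Data.Empty using (⊥-elim)
open import Relation.Binary.PropositionalEquality
  using (_≢_; refl; sym; trans; cong; cong₂; module ≡-Reasoning)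
open import Function using (_∘_)

open ≡-Reasoning

sumOver : {I : Set} → (I → ℤ) → List I → ℤ
sumOver f xs = sumℤ (map f xs)

sumOver-cong : {I : Set} {f g : I → ℤ} (xs : List I) →
  (∀ x → f x ≡ g x) → sumOver f xs ≡ sumOver g xs
sumOver-cong []       f≡g = refl
sumOver-cong (x ∷ xs) f≡g = cong₂ _+_ (f≡g x) (sumOver-cong xs f≡g)

sumOver-zero : {I : Set} {f : I → ℤ} (xs : List I) →
  (∀ x → f x ≡ 0ℤ) → sumOver f xs ≡ 0ℤ
sumOver-zero []       f≡0 = refl
sumOver-zero (x ∷ xs) f≡0 = cong₂ _+_ (f≡0 x) (sumOver-zero xs f≡0)

sumOver-+ : {I : Set} (f g : I → ℤ) (xs : List I) →
  sumOver (λ x → f x + g x) xs ≡ sumOver f xs + sumOver g xs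
sumOver-+ f g []       = refl
sumOver-+ f g (x ∷ xs) = begin
  (f x + g x) + sumOver (λ x → f x + g x) xs ≡⟨ cong ((f x + g x) +_) (sumOver-+ f g xs) ⟩
  (f x + g x) + (sumOver f xs + sumOver g xs) ≡⟨ interchange (f x) (g x) (sumOver f xs) (sumOver g xs) ⟩
  (f x + sumOver f xs) + (g x + sumOver g xs) ∎

sumℤ-++ : (as bs : List ℤ) → sumℤ (as ++ bs) ≡ sumℤ as + sumℤ bs
sumℤ-++ []       bs = sym (ℤP.+-identityˡ (sumℤ bs))
sumℤ-++ (a ∷ as) bs =
  trans (cong (a +_) (sumℤ-++ as bs)) (sym (ℤP.+-assoc a (sumℤ as) (sumℤ bs)))

sumℤ-concatMap : {I : Set} (G : I → List ℤ) (xs : List I) →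
  sumℤ (concatMap G xs) ≡ sumOver (sumℤ ∘ G) xs
sumℤ-concatMap G []       = refl
sumℤ-concatMap G (x ∷ xs) =
  trans (sumℤ-++ (G x) (concatMap G xs)) (cong (sumℤ (G x) +_) (sumℤ-concatMap G xs))

sumOver-concatMap : {I J : Set} (f : J → ℤ) (G : I → List J) (xs : List I) →
  sumOver f (concatMap G xs) ≡ sumOver (λ x → sumOver f (G x)) xs
sumOver-concatMap f G xs =
  trans (cong sumℤ (map-concatMap f G xs)) (sumℤ-concatMap (map f ∘ G) xs)

sumOver-upTo-first-two : (F : ℕ → ℤ) (m : ℕ) → (∀ i → F (2 +ℕ i) ≡ 0ℤ) →
  sumOver F (upTo (2 +ℕ m)) ≡ F 0 + F 1
sumOver-upTo-first-two F m tail≡0 =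
  trans (cong (λ r → F 0 + (F 1 + r)) (rest≡0 m (2 +ℕ_) tail≡0))
        (cong (F 0 +_) (ℤP.+-identityʳ (F 1)))
  where
  rest≡0 : ∀ k (f : ℕ → ℕ) → (∀ i → F (f i) ≡ 0ℤ) → sumOver F (applyUpTo f k) ≡ 0ℤ
  rest≡0 zero    f F∘f≡0 = refl
  rest≡0 (suc k) f F∘f≡0 = cong₂ _+_ (F∘f≡0 0) (rest≡0 k (f ∘ suc) (F∘f≡0 ∘ suc))

ΣWord : (Word → ℤ) → ℤ
ΣWord g = sumOver g allWords

ΣLists : ℕ → (List Word → ℤ) → ℤ
ΣLists zero    f = f []
ΣLists (suc k) f = ΣWord (λ v → ΣLists k (λ ws → f (v ∷ ws)))

ΣLists-cong : ∀ k {f g : List Word → ℤ} → (∀ ws → f ws ≡ g ws) → ΣLists k f ≡ ΣLists k g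
ΣLists-cong zero    f≡g = f≡g []
ΣLists-cong (suc k) f≡g = sumOver-cong allWords (λ v → ΣLists-cong k (λ ws → f≡g (v ∷ ws)))

ΣLists-zero : ∀ k {f : List Word → ℤ} → (∀ ws → f ws ≡ 0ℤ) → ΣLists k f ≡ 0ℤ
ΣLists-zero zero    f≡0 = f≡0 []
ΣLists-zero (suc k) f≡0 = sumOver-zero allWords (λ v → ΣLists-zero k (λ ws → f≡0 (v ∷ ws)))

ΣLists-+ : ∀ k (f g : List Word → ℤ) → ΣLists k (λ ws → f ws + g ws) ≡ ΣLists k f + ΣLists k g
ΣLists-+ zero    f g = refl
ΣLists-+ (suc k) f g =
  trans (sumOver-cong allWords (λ v → ΣLists-+ k (λ ws → f (v ∷ ws)) (λ ws → g (v ∷ ws))))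
        (sumOver-+ (λ v → ΣLists k (λ ws → f (v ∷ ws))) (λ v → ΣLists k (λ ws → g (v ∷ ws))) allWords)

ΣLists-byLast : ∀ k (f : List Word → ℤ) →
  ΣLists (suc k) f ≡ ΣLists k (λ ws → ΣWord (λ v → f (ws ++ v ∷ [])))
ΣLists-byLast zero    f = refl
ΣLists-byLast (suc k) f = sumOver-cong allWords (λ v → ΣLists-byLast k (λ ws → f (v ∷ ws)))

ΣLists-wordListsOfLength : ∀ k (f : List Word → ℤ) → sumOver f (wordListsOfLength k) ≡ ΣLists k f
ΣLists-wordListsOfLength zero    f = ℤP.+-identityʳ (f [])
ΣLists-wordListsOfLength (suc k) f =
  trans (sumOver-concatMap f (λ v → map (v ∷_) (wordListsOfLength k)) allWords)
        (sumOver-cong allWords (λ v →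
          trans (cong sumℤ (sym (map-∘ {g = f} {f = v ∷_} (wordListsOfLength k))))
                (ΣLists-wordListsOfLength k (λ ws → f (v ∷ ws)))))

sumOver-wordListsUpTo : ∀ n (f : List Word → ℤ) →
  sumOver f (wordListsUpTo n) ≡ sumOver (λ k → ΣLists k f) (upTo (suc n))
sumOver-wordListsUpTo n f =
  trans (sumOver-concatMap f wordListsOfLength (upTo (suc n)))
        (sumOver-cong (upTo (suc n)) (λ k → ΣLists-wordListsOfLength k f))

-- The six words other than ABA and BA.  None of them is a suffix of ABA, and
-- none of them begins with AB or with B.
data OtherWord : Word → Set where
  oX : OtherWord wX
  oXA : OtherWord wXA
  oXAA : OtherWord wXAA
  oAXA : OtherWord wAXA
  oAAA : OtherWord wAAA
  oXXA : OtherWord wXXA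

ΣWord-ABA-BA : (g : Word → ℤ) → (∀ {u} → OtherWord u → g u ≡ 0ℤ) → ΣWord g ≡ g wABA + g wBA
ΣWord-ABA-BA g g≡0
  rewrite g≡0 oX | g≡0 oXA | g≡0 oXAA | g≡0 oAXA | g≡0 oAAA | g≡0 oXXA =
  collect (g wABA) (g wBA)
  where
  -- What remains of the sum over allWords once the six terms are zero.
  collect : ∀ a b → 0ℤ + (0ℤ + (0ℤ + (0ℤ + (0ℤ + (b + (a + (0ℤ + 0ℤ))))))) ≡ a + b
  collect = solve-∀

ΣLists-byFirst-ABA-BA : ∀ k (f : List Word → ℤ) → (∀ {u} → OtherWord u → ∀ ws → f (u ∷ ws) ≡ 0ℤ) →
  ΣLists (suc k) f ≡ ΣLists k (λ ws → f (wABA ∷ ws)) + ΣLists k (λ ws → f (wBA ∷ ws))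
ΣLists-byFirst-ABA-BA k f f≡0 = ΣWord-ABA-BA _ (λ o → ΣLists-zero k (f≡0 o))

ΣLists-byLast-ABA-BA : ∀ k (f : List Word → ℤ) → (∀ {u} → OtherWord u → ∀ ws → f (ws ++ u ∷ []) ≡ 0ℤ) →
  ΣLists (suc k) f ≡ ΣLists k (λ ws → f (ws ++ wABA ∷ [])) + ΣLists k (λ ws → f (ws ++ wBA ∷ []))
ΣLists-byLast-ABA-BA k f f≡0 =
  trans (ΣLists-byLast k f)
  (trans (ΣLists-cong k (λ ws → ΣWord-ABA-BA _ (λ o → f≡0 o ws)))
         (ΣLists-+ k _ _))

eqLetter-sound : ∀ a b → eqLetter a b ≡ true → a ≡ b
eqLetter-sound A A _ = refl
eqLetter-sound B B _ = refl
eqLetter-sound X X _ = refl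
eqLetter-sound A B ()
eqLetter-sound A X ()
eqLetter-sound B A ()
eqLetter-sound B X ()
eqLetter-sound X A ()
eqLetter-sound X B ()

eqString-sound : ∀ u v → eqString u v ≡ true → u ≡ v
eqString-sound []      []      _ = refl
eqString-sound []      (_ ∷ _) ()
eqString-sound (_ ∷ _) []      ()
eqString-sound (a ∷ u) (b ∷ v) eq with eqLetter a b in a≟b
... | true = cong₂ _∷_ (eqLetter-sound a b a≟b) (eqString-sound u v eq)

eqString-refl : ∀ u → eqString u u ≡ true
eqString-refl []      = refl
eqString-refl (A ∷ u) = eqString-refl u
eqString-refl (B ∷ u) = eqString-refl u
eqString-refl (X ∷ u) = eqString-refl u

eqString-false : ∀ u v → u ≢ v → eqString u v ≡ false
eqString-false u v u≢v with eqString u v in u≟v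
... | true  = ⊥-elim (u≢v (eqString-sound u v u≟v))
... | false = refl

eqString-++ʳ : ∀ u v s → eqString (u ++ s) (v ++ s) ≡ eqString u v
eqString-++ʳ u v s with eqString u v in u≟v
... | true  rewrite eqString-sound u v u≟v = eqString-refl (v ++ s)
... | false = eqString-false (u ++ s) (v ++ s) (λ eq → true≢false
                (trans (sym (eqString-refl u)) (trans (cong (eqString u) (++-cancelʳ s u v eq)) u≟v)))
  where
  true≢false : ¬ (true ≡ false)
  true≢false ()

concatW-++ : ∀ xs ys → concatW (xs ++ ys) ≡ concatW xs ++ concatW ys
concatW-++ []       ys = refl
concatW-++ (x ∷ xs) ys =
  trans (cong (spell x ++_) (concatW-++ xs ys)) (sym (++-assoc (spell x) (concatW xs) (concatW ys)))

concatW-snoc : ∀ ws v → concatW (ws ++ v ∷ []) ≡ concatW ws ++ spell v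
concatW-snoc ws v = trans (concatW-++ ws (v ∷ [])) (cong (concatW ws ++_) (++-identityʳ (spell v)))

eqString-snoc : ∀ ws v V → eqString (concatW ws) V ≡ eqString (concatW (ws ++ v ∷ [])) (V ++ spell v)
eqString-snoc ws v V =
  trans (sym (eqString-++ʳ (concatW ws) V (spell v)))
        (cong (λ s → eqString s (V ++ spell v)) (sym (concatW-snoc ws v)))

reverse-both : ∀ (xs ys us vs : String) → xs ++ ys ≡ us ++ vs → reverse ys ++ reverse xs ≡ reverse vs ++ reverse us
reverse-both xs ys us vs eq = trans (sym (reverse-++ xs ys)) (trans (cong reverse eq) (reverse-++ us vs))

otherWord-not-suffix-ABA : ∀ {v} → OtherWord v → ∀ xs ys → xs ++ spell v ≢ ys ++ A ∷ B ∷ A ∷ []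
otherWord-not-suffix-ABA {v} o xs ys eq = mismatch o (reverse-both xs (spell v) ys (A ∷ B ∷ A ∷ []) eq)
  where
  mismatch : ∀ {v r s} → OtherWord v → reverse (spell v) ++ r ≢ A ∷ B ∷ A ∷ s
  mismatch oX ()
  mismatch oXA ()
  mismatch oXAA ()
  mismatch oAXA ()
  mismatch oAAA ()
  mismatch oXXA ()

word-not-suffix-B : ∀ v xs ys → xs ++ spell v ≢ ys ++ B ∷ []
word-not-suffix-B v xs ys eq = mismatch v (reverse-both xs (spell v) ys (B ∷ []) eq)
  where
  mismatch : ∀ v {r s} → reverse (spell v) ++ r ≢ B ∷ s
  mismatch wX ()
  mismatch wXA ()
  mismatch wXAA ()
  mismatch wAXA ()
  mismatch wAAA ()
  mismatch wBA ()
  mismatch wABA ()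
  mismatch wXXA ()

coefP-++ : ∀ xs ys → coefP (xs ++ ys) ≡ coefP xs * coefP ys
coefP-++ []       ys = sym (ℤP.*-identityˡ (coefP ys))
coefP-++ (x ∷ xs) ys =
  trans (cong (coef x *_) (coefP-++ xs ys)) (sym (ℤP.*-assoc (coef x) (coefP xs) (coefP ys)))

weightP-++ : ∀ xs ys → weightP (xs ++ ys) ≡ weightP xs +ℕ weightP ys
weightP-++ []       ys = refl
weightP-++ (x ∷ xs) ys =
  trans (cong (weight x +ℕ_) (weightP-++ xs ys)) (sym (ℕP.+-assoc (weight x) (weightP xs) (weightP ys)))

coefP-rotate : ∀ v ws → coefP (v ∷ ws) ≡ coefP (ws ++ v ∷ [])
coefP-rotate v ws = begin
  coef v * coefP ws            ≡⟨ ℤP.*-comm (coef v) (coefP ws) ⟩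
  coefP ws * coef v            ≡⟨ cong (coefP ws *_) (sym (ℤP.*-identityʳ (coef v))) ⟩
  coefP ws * coefP (v ∷ [])    ≡⟨ sym (coefP-++ ws (v ∷ [])) ⟩
  coefP (ws ++ v ∷ [])         ∎

weightP-rotate : ∀ v ws → weightP (v ∷ ws) ≡ weightP (ws ++ v ∷ [])
weightP-rotate v ws = begin
  weight v +ℕ weightP ws         ≡⟨ ℕP.+-comm (weight v) (weightP ws) ⟩
  weightP ws +ℕ weight v         ≡⟨ cong (weightP ws +ℕ_) (sym (ℕP.+-identityʳ (weight v))) ⟩
  weightP ws +ℕ weightP (v ∷ []) ≡⟨ sym (weightP-++ ws (v ∷ [])) ⟩
  weightP (ws ++ v ∷ [])         ∎

lastOf : Word → List Word → Word
lastOf x []       = x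
lastOf x (y ∷ ys) = lastOf y ys

initOf : Word → List Word → List Word
initOf x []       = []
initOf x (y ∷ ys) = x ∷ initOf y ys

last-lastOf : ∀ x xs → last (x ∷ xs) ≡ just (lastOf x xs)
last-lastOf x []       = refl
last-lastOf x (y ∷ ys) = last-lastOf y ys

initOf-lastOf : ∀ x xs → x ∷ xs ≡ initOf x xs ++ lastOf x xs ∷ []
initOf-lastOf x []       = refl
initOf-lastOf x (y ∷ ys) = cong (x ∷_) (initOf-lastOf y ys)

cycAdmissible-∷ : ∀ u ws → cycAdmissible (u ∷ ws) ≡ admissible (u ∷ ws) ∧ not (forbidden (lastOf u ws) u)
cycAdmissible-∷ u ws with last (u ∷ ws) | last-lastOf u ws
... | just .(lastOf u ws) | refl = refl

lastLongerThan-∷ : ∀ s u ws → lastLongerThan s (u ∷ ws) ≡ (s <ᵇ length (spell (lastOf u ws)))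
lastLongerThan-∷ s u ws with last (u ∷ ws) | last-lastOf u ws
... | just .(lastOf u ws) | refl = refl

admissible-cons-free : ∀ u ws → (∀ v → forbidden u v ≡ false) → admissible (u ∷ ws) ≡ admissible ws
admissible-cons-free u []       free = refl
admissible-cons-free u (v ∷ ws) free = cong (λ b → not b ∧ admissible (v ∷ ws)) (free v)

admissible-snoc : ∀ x xs v →
  admissible ((x ∷ xs) ++ v ∷ []) ≡ admissible (x ∷ xs) ∧ not (forbidden (lastOf x xs) v)
admissible-snoc x []       v = ∧-identityʳ (not (forbidden x v))
admissible-snoc x (y ∷ ys) v =
  trans (cong (not (forbidden x y) ∧_) (admissible-snoc y ys v))
        (sym (∧-assoc (not (forbidden x y)) (admissible (y ∷ ys)) _))

admissible-snoc-free : ∀ ws v → (∀ u → forbidden u v ≡ false) → admissible (ws ++ v ∷ []) ≡ admissible ws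
admissible-snoc-free []       v free = refl
admissible-snoc-free (x ∷ xs) v free =
  trans (admissible-snoc x xs v)
        (trans (cong (λ b → admissible (x ∷ xs) ∧ not b) (free (lastOf x xs))) (∧-identityʳ _))

wordLength-pos : ∀ u → (0 <ᵇ length (spell u)) ≡ true
wordLength-pos wX   = refl
wordLength-pos wXA  = refl
wordLength-pos wXAA = refl
wordLength-pos wAXA = refl
wordLength-pos wAAA = refl
wordLength-pos wBA  = refl
wordLength-pos wABA = refl
wordLength-pos wXXA = refl

wordLength-≤3 : ∀ i u → (3 +ℕ i <ᵇ length (spell u)) ≡ false
wordLength-≤3 i wX   = refl
wordLength-≤3 i wXA  = refl
wordLength-≤3 i wXAA = refl
wordLength-≤3 i wAXA = refl
wordLength-≤3 i wAAA = refl
wordLength-≤3 i wBA  = refl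
wordLength-≤3 i wABA = refl
wordLength-≤3 i wXXA = refl

ABA-never-forbidden : ∀ u → forbidden u wABA ≡ false
ABA-never-forbidden wX   = refl
ABA-never-forbidden wXA  = refl
ABA-never-forbidden wXAA = refl
ABA-never-forbidden wAXA = refl
ABA-never-forbidden wAAA = refl
ABA-never-forbidden wBA  = refl
ABA-never-forbidden wABA = refl
ABA-never-forbidden wXXA = refl

-- The only word of length ≤ 1, namely X, is forbidden before BA; so
-- requiring length > 1 adds nothing to "u may precede BA".
longWord-before-BA : ∀ u a →
  ((1 <ᵇ length (spell u)) ∧ (a ∧ not (forbidden u wBA))) ≡ (a ∧ not (forbidden u wBA))
longWord-before-BA wX   a = sym (∧-zeroʳ a)
longWord-before-BA wXA  a = refl
longWord-before-BA wXAA a = refl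
longWord-before-BA wAXA a = refl
longWord-before-BA wAAA a = refl
longWord-before-BA wBA  a = refl
longWord-before-BA wABA a = refl
longWord-before-BA wXXA a = refl

-- A cut at position ≥ 3 is never the smallest one: no word is long enough.
lastLongerThan-≥3 : ∀ i ws → lastLongerThan (3 +ℕ i) ws ≡ false
lastLongerThan-≥3 i []       = refl
lastLongerThan-≥3 i (x ∷ xs) = trans (lastLongerThan-∷ (3 +ℕ i) x xs) (wordLength-≤3 i (lastOf x xs))

-- The correspondence between cyclic parsings of (ABA·W) and locked parsings of [W·ABA]

module Correspondence (W : String) (w : ℕ) where

  U : String
  U = A ∷ B ∷ A ∷ W

  U' : String
  U' = W ++ A ∷ B ∷ A ∷ []

  cycTerm : ℕ → List Word → ℤ
  cycTerm s ws = if isCyclicParsing U s ws ∧ (weightP ws ≡ᵇ w) then coefP ws else 0ℤ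

  lockTerm : List Word → ℤ
  lockTerm ws = if isLockedParsing U' ws ∧ (weightP ws ≡ᵇ w) then coefP ws else 0ℤ

  cycTerm-vanishes : ∀ s ws → isCyclicParsing U s ws ≡ false → cycTerm s ws ≡ 0ℤ
  cycTerm-vanishes s ws notParsing = cong (λ b → if b ∧ (weightP ws ≡ᵇ w) then coefP ws else 0ℤ) notParsing

  lockTerm-vanishes : ∀ ws → eqString (concatW ws) U' ≡ false → lockTerm ws ≡ 0ℤ
  lockTerm-vanishes ws noMatch =
    cong (λ b → if (b ∧ admissible ws) ∧ (weightP ws ≡ᵇ w) then coefP ws else 0ℤ) noMatch

  terms-agree : ∀ s v ws → isCyclicParsing U s (v ∷ ws) ≡ isLockedParsing U' (ws ++ v ∷ []) →
    cycTerm s (v ∷ ws) ≡ lockTerm (ws ++ v ∷ [])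
  terms-agree s v ws parsing≡ =
    cong₂ (λ b c → if b then c else 0ℤ)
          (cong₂ _∧_ parsing≡ (cong (_≡ᵇ w) (weightP-rotate v ws)))
          (coefP-rotate v ws)

  lockTerm-[] : lockTerm [] ≡ 0ℤ
  lockTerm-[] = lockTerm-vanishes [] (eqString-false [] U' (nonempty W))
    where
    nonempty : ∀ V → [] ≢ V ++ A ∷ B ∷ A ∷ []
    nonempty []      ()
    nonempty (_ ∷ _) ()

  lockTerm-otherLast : ∀ {u} → OtherWord u → ∀ ws → lockTerm (ws ++ u ∷ []) ≡ 0ℤ
  lockTerm-otherLast {u} o ws = lockTerm-vanishes (ws ++ u ∷ [])
    (eqString-false _ U' (λ eq → otherWord-not-suffix-ABA o (concatW ws) W (trans (sym (concatW-snoc ws u)) eq)))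

  cycTerm-ABA : ∀ P → cycTerm 0 (wABA ∷ P) ≡ lockTerm (P ++ wABA ∷ [])
  cycTerm-ABA P = terms-agree 0 wABA P (cong₂ _∧_ concat≡ admissible≡)
    where
    concat≡ : eqString (concatW P) (W ++ []) ≡ eqString (concatW (P ++ wABA ∷ [])) U'
    concat≡ = trans (cong (eqString (concatW P)) (++-identityʳ W)) (eqString-snoc P wABA W)

    admissible≡ : lastLongerThan 0 (wABA ∷ P) ∧ cycAdmissible (wABA ∷ P) ≡ admissible (P ++ wABA ∷ [])
    admissible≡ = begin
      lastLongerThan 0 (wABA ∷ P) ∧ cycAdmissible (wABA ∷ P)
        ≡⟨ cong₂ _∧_ (trans (lastLongerThan-∷ 0 wABA P) (wordLength-pos (lastOf wABA P)))
                     (cycAdmissible-∷ wABA P) ⟩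
      admissible (wABA ∷ P) ∧ not (forbidden (lastOf wABA P) wABA)
        ≡⟨ cong (λ b → admissible (wABA ∷ P) ∧ not b) (ABA-never-forbidden (lastOf wABA P)) ⟩
      admissible (wABA ∷ P) ∧ true
        ≡⟨ ∧-identityʳ _ ⟩
      admissible (wABA ∷ P)
        ≡⟨ admissible-cons-free wABA P (λ _ → refl) ⟩
      admissible P
        ≡⟨ sym (admissible-snoc-free P wABA ABA-never-forbidden) ⟩
      admissible (P ++ wABA ∷ []) ∎

  cycTerm-BA : ∀ R → cycTerm 1 (wBA ∷ R) ≡ lockTerm (R ++ wBA ∷ [])
  cycTerm-BA R = terms-agree 1 wBA R (cong₂ _∧_ concat≡ (admissible≡ R))
    where
    concat≡ : eqString (concatW R) (W ++ A ∷ []) ≡ eqString (concatW (R ++ wBA ∷ [])) U'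
    concat≡ = trans (eqString-snoc R wBA (W ++ A ∷ []))
                    (cong (eqString (concatW (R ++ wBA ∷ []))) (++-assoc W (A ∷ []) (B ∷ A ∷ [])))

    admissible≡ : ∀ R → lastLongerThan 1 (wBA ∷ R) ∧ cycAdmissible (wBA ∷ R) ≡ admissible (R ++ wBA ∷ [])
    admissible≡ []       = refl
    admissible≡ (x ∷ xs) = begin
      lastLongerThan 1 (wBA ∷ x ∷ xs) ∧ cycAdmissible (wBA ∷ x ∷ xs)
        ≡⟨ cong₂ _∧_ (lastLongerThan-∷ 1 wBA (x ∷ xs)) (cycAdmissible-∷ wBA (x ∷ xs)) ⟩
      (1 <ᵇ length (spell l)) ∧ (admissible (wBA ∷ x ∷ xs) ∧ not (forbidden l wBA))
        ≡⟨ cong (λ a → (1 <ᵇ length (spell l)) ∧ (a ∧ not (forbidden l wBA)))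
                (admissible-cons-free wBA (x ∷ xs) (λ _ → refl)) ⟩
      (1 <ᵇ length (spell l)) ∧ (admissible (x ∷ xs) ∧ not (forbidden l wBA))
        ≡⟨ longWord-before-BA l (admissible (x ∷ xs)) ⟩
      admissible (x ∷ xs) ∧ not (forbidden l wBA)
        ≡⟨ sym (admissible-snoc x xs wBA) ⟩
      admissible ((x ∷ xs) ++ wBA ∷ []) ∎
      where
      l = lastOf x xs

  -- Smallest cut 2 is impossible: the rotation A·W·AB ends in B.
  cycTerm-2 : ∀ ws → cycTerm 2 ws ≡ 0ℤ
  cycTerm-2 []       = refl
  cycTerm-2 (x ∷ xs) = cycTerm-vanishes 2 (x ∷ xs)
    (cong (_∧ _) (eqString-false (concatW (x ∷ xs)) ((A ∷ W) ++ A ∷ B ∷ []) endsInB))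
    where
    endsInB : concatW (x ∷ xs) ≢ (A ∷ W) ++ A ∷ B ∷ []
    endsInB eq = word-not-suffix-B (lastOf x xs) (concatW (initOf x xs)) ((A ∷ W) ++ A ∷ [])
      (begin
        concatW (initOf x xs) ++ spell (lastOf x xs) ≡⟨ sym (concatW-snoc (initOf x xs) (lastOf x xs)) ⟩
        concatW (initOf x xs ++ lastOf x xs ∷ [])    ≡⟨ cong concatW (sym (initOf-lastOf x xs)) ⟩
        concatW (x ∷ xs)                              ≡⟨ eq ⟩
        (A ∷ W) ++ A ∷ B ∷ []                         ≡⟨ sym (++-assoc (A ∷ W) (A ∷ []) (B ∷ [])) ⟩
        ((A ∷ W) ++ A ∷ []) ++ B ∷ []                 ∎)

  -- Smallest cut ≥ 3 is impossible: the wrapping last word would be too long.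
  cycTerm-≥3 : ∀ i ws → cycTerm (3 +ℕ i) ws ≡ 0ℤ
  cycTerm-≥3 i ws = cycTerm-vanishes (3 +ℕ i) ws (begin
    matches ∧ (lastLongerThan (3 +ℕ i) ws ∧ cycAdmissible ws)
      ≡⟨ cong (λ b → matches ∧ (b ∧ cycAdmissible ws)) (lastLongerThan-≥3 i ws) ⟩
    matches ∧ false
      ≡⟨ ∧-zeroʳ matches ⟩
    false ∎)
    where
    matches = eqString (concatW ws) (rotate (3 +ℕ i) U)

  ΣLists-cyc≡lock : ∀ k → ΣLists k (cycTerm 0) + ΣLists k (cycTerm 1) ≡ ΣLists k lockTerm
  ΣLists-cyc≡lock zero    = sym lockTerm-[]
  ΣLists-cyc≡lock (suc k) = begin
    ΣLists (suc k) (cycTerm 0) + ΣLists (suc k) (cycTerm 1)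
      ≡⟨ cong₂ _+_ (ΣLists-byFirst-ABA-BA k (cycTerm 0) startsWithAB)
                   (ΣLists-byFirst-ABA-BA k (cycTerm 1) startsWithB) ⟩
    (ΣLists k (cycTerm 0 ∘ (wABA ∷_)) + ΣLists k (cycTerm 0 ∘ (wBA ∷_)))
      + (ΣLists k (cycTerm 1 ∘ (wABA ∷_)) + ΣLists k (cycTerm 1 ∘ (wBA ∷_)))
      ≡⟨ cong₂ (λ a b → (ΣLists k (cycTerm 0 ∘ (wABA ∷_)) + a) + (b + ΣLists k (cycTerm 1 ∘ (wBA ∷_))))
               (ΣLists-zero k (λ _ → refl)) (ΣLists-zero k (λ _ → refl)) ⟩
    (ΣLists k (cycTerm 0 ∘ (wABA ∷_)) + 0ℤ) + (0ℤ + ΣLists k (cycTerm 1 ∘ (wBA ∷_)))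
      ≡⟨ cong₂ _+_ (ℤP.+-identityʳ (ΣLists k (cycTerm 0 ∘ (wABA ∷_)))) (ℤP.+-identityˡ (ΣLists k (cycTerm 1 ∘ (wBA ∷_)))) ⟩
    ΣLists k (cycTerm 0 ∘ (wABA ∷_)) + ΣLists k (cycTerm 1 ∘ (wBA ∷_))
      ≡⟨ cong₂ _+_ (ΣLists-cong k cycTerm-ABA) (ΣLists-cong k cycTerm-BA) ⟩
    ΣLists k (λ P → lockTerm (P ++ wABA ∷ [])) + ΣLists k (λ R → lockTerm (R ++ wBA ∷ []))
      ≡⟨ sym (ΣLists-byLast-ABA-BA k lockTerm lockTerm-otherLast) ⟩
    ΣLists (suc k) lockTerm ∎
    where
    -- The rotation with smallest cut 0 begins with AB, the one with
    -- smallest cut 1 begins with B; the other words do not fit.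
    startsWithAB : ∀ {u} → OtherWord u → ∀ ws → cycTerm 0 (u ∷ ws) ≡ 0ℤ
    startsWithAB oX _ = refl
    startsWithAB oXA _ = refl
    startsWithAB oXAA _ = refl
    startsWithAB oAXA _ = refl
    startsWithAB oAAA _ = refl
    startsWithAB oXXA _ = refl

    startsWithB : ∀ {u} → OtherWord u → ∀ ws → cycTerm 1 (u ∷ ws) ≡ 0ℤ
    startsWithB oX _ = refl
    startsWithB oXA _ = refl
    startsWithB oXAA _ = refl
    startsWithB oAXA _ = refl
    startsWithB oAAA _ = refl
    startsWithB oXXA _ = refl

  sum-cyc≡lock : ∀ n →
    sumOver (cycTerm 0) (wordListsUpTo n) + sumOver (cycTerm 1) (wordListsUpTo n) ≡ sumOver lockTerm (wordListsUpTo n)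
  sum-cyc≡lock n = begin
    sumOver (cycTerm 0) (wordListsUpTo n) + sumOver (cycTerm 1) (wordListsUpTo n)
      ≡⟨ cong₂ _+_ (sumOver-wordListsUpTo n (cycTerm 0)) (sumOver-wordListsUpTo n (cycTerm 1)) ⟩
    sumOver (λ k → ΣLists k (cycTerm 0)) (upTo (suc n)) + sumOver (λ k → ΣLists k (cycTerm 1)) (upTo (suc n))
      ≡⟨ sym (sumOver-+ (λ k → ΣLists k (cycTerm 0)) (λ k → ΣLists k (cycTerm 1)) (upTo (suc n))) ⟩
    sumOver (λ k → ΣLists k (cycTerm 0) + ΣLists k (cycTerm 1)) (upTo (suc n))
      ≡⟨ sumOver-cong (upTo (suc n)) ΣLists-cyc≡lock ⟩
    sumOver (λ k → ΣLists k lockTerm) (upTo (suc n))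
      ≡⟨ sym (sumOver-wordListsUpTo n lockTerm) ⟩
    sumOver lockTerm (wordListsUpTo n) ∎

  sumOver-cycTerm-≥2 : ∀ L i → sumOver (cycTerm (2 +ℕ i)) L ≡ 0ℤ
  sumOver-cycTerm-≥2 L zero    = sumOver-zero L cycTerm-2
  sumOver-cycTerm-≥2 L (suc i) = sumOver-zero L (cycTerm-≥3 i)

lemma4p11 : (W : List Letter) → (w : ℕ) →
    cCyclic (A ∷ B ∷ A ∷ W) w ≡ cLocked (W ++ A ∷ B ∷ A ∷ []) w
lemma4p11 W w = begin
  cCyclic U w
    ≡⟨ sumℤ-concatMap (λ s → map (cycTerm s) L) (upTo n) ⟩
  sumOver (λ s → sumOver (cycTerm s) L) (upTo n)
    ≡⟨ sumOver-upTo-first-two (λ s → sumOver (cycTerm s) L) (suc (length W)) (sumOver-cycTerm-≥2 L) ⟩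
  sumOver (cycTerm 0) L + sumOver (cycTerm 1) L
    ≡⟨ sum-cyc≡lock n ⟩
  sumOver lockTerm L
    ≡⟨ cong (sumOver lockTerm ∘ wordListsUpTo) (length-++-comm W (A ∷ B ∷ A ∷ [])) ⟨
  cLocked U' w ∎
  where
  open Correspondence W w
  n : ℕ
  n = length U
  L : List (List Word)
  L = wordListsUpTo n
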